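{- For every fixed integer $k\ge 2$, the complete $k$-ary tree $T_n^k$ with $n$ leaves ($n$ a power of $k$) has a rectangular layout on the integer grid of area $O(n)$.
   Context: A (strong) rectangular layout of a graph is a set of axis-parallel rectangles with pairwise disjoint interiors, one per vertex, such that two rectangles' boundaries share a segment of positive length if and only if the corresponding vertices are adjacent. On the integer grid all corners have integer coordinates; the area is that of the smallest enclosing axis-parallel bounding box. -}

module Defs where

open import Data.Nat as ℕ using (ℕ)
open import Data.Integer using (ℤ; _<_; _≤_; _⊔_; _⊓_; _-_; _*_)
open import Data.Fin using (Fin)
open import Data.List using (List; _∷_; length)
open import Data.Product using (Σ; _×_; ∃; ∃-syntax; proj₁)
open import Data.Sum using (_⊎_)
open import Relation.Nullary using (¬_)
open import Relation.Binary.PropositionalEquality using (_≡_; _≢_)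
open import Function.Bundles using (_⇔_)

-- Complete k-ary tree of depth m (it has k^m leaves).
-- A vertex is the path from the root, a list of child indices
-- (most recent step first), of length at most m.

TreeVertex : ℕ → ℕ → Set
TreeVertex k m = Σ (List (Fin k)) (λ p → length p ℕ.≤ m)

ChildOf : ∀ {k m} → TreeVertex k m → TreeVertex k m → Set
ChildOf {k} u v = ∃[ i ] (proj₁ v ≡ i ∷ proj₁ u)

TreeAdj : ∀ {k m} → TreeVertex k m → TreeVertex k m → Set
TreeAdj u v = ChildOf u v ⊎ ChildOf v u

record Rect : Set where
  field
    x₁ x₂ y₁ y₂ : ℤ
    x₁<x₂ : x₁ < x₂
    y₁<y₂ : y₁ < y₂
open Rect public

-- the open intervals (a,b) and (c,d) intersect, i.e. the closed
-- intervals [a,b] and [c,d] overlap in positive length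
Overlap : ℤ → ℤ → ℤ → ℤ → Set
Overlap a b c d = (a ⊔ c) < (b ⊓ d)

InteriorsDisjoint : Rect → Rect → Set
InteriorsDisjoint R S =
  ¬ (Overlap (x₁ R) (x₂ R) (x₁ S) (x₂ S) × Overlap (y₁ R) (y₂ R) (y₁ S) (y₂ S))

OneOf : ℤ → ℤ → ℤ → Set
OneOf c a b = (c ≡ a) ⊎ (c ≡ b)

-- the boundaries of R and S share a segment of positive length:
-- either a horizontal one (on a common line y = c which carries a
-- horizontal side of both, with positive-length x-overlap) or a
-- vertical one.
ShareBoundarySegment : Rect → Rect → Set
ShareBoundarySegment R S =
  (∃[ c ] (OneOf c (y₁ R) (y₂ R) × OneOf c (y₁ S) (y₂ S)
           × Overlap (x₁ R) (x₂ R) (x₁ S) (x₂ S)))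
  ⊎
  (∃[ c ] (OneOf c (x₁ R) (x₂ R) × OneOf c (x₁ S) (x₂ S)
           × Overlap (y₁ R) (y₂ R) (y₁ S) (y₂ S)))

record RectLayout (V : Set) (Adj : V → V → Set) : Set where
  field
    rect     : V → Rect
    disjoint : ∀ u v → u ≢ v → InteriorsDisjoint (rect u) (rect v)
    contact  : ∀ u v → u ≢ v → (ShareBoundarySegment (rect u) (rect v) ⇔ Adj u v)
open RectLayout public

InBox : ℤ → ℤ → ℤ → ℤ → Rect → Set
InBox X₁ X₂ Y₁ Y₂ R =
  (X₁ ≤ x₁ R) × (x₂ R ≤ X₂) × (Y₁ ≤ y₁ R) × (y₂ R ≤ Y₂)

-- the smallest enclosing axis-parallel bounding box of the layout has
-- area at most A (equivalently: some enclosing box has area ≤ A)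
AreaAtMost : ∀ {V Adj} → RectLayout V Adj → ℤ → Set
AreaAtMost {V} L A =
  ∃[ X₁ ] ∃[ X₂ ] ∃[ Y₁ ] ∃[ Y₂ ]
    ((∀ v → InBox X₁ X₂ Y₁ Y₂ (rect L v)) × ((X₂ - X₁) * (Y₂ - Y₁) ≤ A))

{-# OPTIONS --safe #-}
-- The layout of the tree of depth m + 1 consists of a root strip [0,1] × [0,H]
-- with k transposed copies of the layout of depth m stacked along its right
-- side, separated by unit gaps.  Transposition and translation preserve
-- disjointness and contacts, the gaps rule out every contact between distinct
-- copies, and of a copy only its root meets the strip.  The width and height
-- obey W' = 1 + H and H' = k (1 + W), so for k ≥ 2 the quantity (W + 3)(H + 4)
-- grows by at most a factor k per level, which bounds the area by 20 kᵐ.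
module Submission where

open import Defs
open import Data.Nat using (ℕ; _≤_; _^_; _*_)
open import Data.Integer using (+_)
open import Data.Product using (Σ; ∃; ∃-syntax)

open import Data.Empty using (⊥-elim)
open import Data.Fin using (Fin; toℕ)
import Data.Fin.Properties as Fin
import Data.Integer as ℤ
import Data.Integer.Properties as ℤ
open import Data.List using (List; []; _∷_; _∷ʳ_; length; reverse)
import Data.List.Properties as List
open import Data.Nat
  using (zero; suc; _+_; _<_; z≤n; s≤s; z<s; NonZero; >-nonZero; >-nonZero⁻¹)
open import Data.Nat.Properties
import Data.Product as Prod
open import Data.Product using (_×_; _,_; proj₁)
import Data.Sum as Sum
open import Data.Sum using (_⊎_; inj₁; inj₂)
open import Data.Sum.Function.Propositional using (_⊎-⇔_)
open import Function using (id; _∘_)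
open import Function.Bundles using (_⇔_; mk⇔; Equivalence)
open import Function.Construct.Composition using (_⇔-∘_)
open import Function.Construct.Symmetry using (⇔-sym)
open import Function.Definitions using (Injective)
open import Relation.Binary using (tri<; tri≈; tri>)
open import Relation.Binary.PropositionalEquality
open import Relation.Nullary using (¬_; contradiction)

open import Algebra.Properties.CommutativeSemigroup *-commutativeSemigroup using (x∙yz≈y∙xz)

open Equivalence using (to; from)

record Interval : Set where
  constructor interval
  field
    lo hi : ℕ
    lo<hi : lo < hi
open Interval

record Overlaps (I J : Interval) : Set where
  constructor overlapping
  field
    lo₁<hi₂ : lo I < hi J
    lo₂<hi₁ : lo J < hi I

EndpointVia : {A : Set} → (ℕ → A) → A → Interval → Set
EndpointVia f c I = c ≡ f (lo I) ⊎ c ≡ f (hi I)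

Endpoint : ℕ → Interval → Set
Endpoint = EndpointVia id

data ShareEndpoint (I J : Interval) : Set where
  sharing : ∀ {n} → Endpoint n I → Endpoint n J → ShareEndpoint I J

Precedes : Interval → Interval → Set
Precedes I J = hi I < lo J

shift : ℕ → Interval → Interval
shift d I = interval (d + lo I) (d + hi I) (+-monoʳ-< d (lo<hi I))

shareEndpoint⇔via : {A : Set} {f : ℕ → A} → Injective _≡_ _≡_ f → ∀ {I J} →
                  ShareEndpoint I J ⇔ (∃[ c ] (EndpointVia f c I × EndpointVia f c J))
shareEndpoint⇔via {f = f} f-injective {I} {J} = mk⇔ embed forget
  where
  embed : ShareEndpoint I J → ∃[ c ] (EndpointVia f c I × EndpointVia f c J)
  embed (sharing {n} nI nJ) = f n , Sum.map (cong f) (cong f) nI , Sum.map (cong f) (cong f) nJ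

  preimage : ∀ {c} K → EndpointVia f c K → ∃[ n ] (c ≡ f n × Endpoint n K)
  preimage K (inj₁ c≡) = lo K , c≡ , inj₁ refl
  preimage K (inj₂ c≡) = hi K , c≡ , inj₂ refl

  forget : ∃[ c ] (EndpointVia f c I × EndpointVia f c J) → ShareEndpoint I J
  forget (c , cI , cJ) with preimage I cI
  ... | n , refl , nI = sharing nI (Sum.map f-injective f-injective cJ)

module _ {I J : Interval} where

  overlaps-sym : Overlaps I J → Overlaps J I
  overlaps-sym (overlapping p q) = overlapping q p

  shareEndpoint-sym : ShareEndpoint I J → ShareEndpoint J I
  shareEndpoint-sym (sharing nI nJ) = sharing nJ nI

  overlaps-shift⇔ : ∀ d → Overlaps (shift d I) (shift d J) ⇔ Overlaps I J
  overlaps-shift⇔ d = mk⇔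
    (λ (overlapping p q) → overlapping (+-cancelˡ-< d _ _ p) (+-cancelˡ-< d _ _ q))
    (λ (overlapping p q) → overlapping (+-monoʳ-< d p) (+-monoʳ-< d q))

  shareEndpoint-shift⇔ : ∀ d → ShareEndpoint (shift d I) (shift d J) ⇔ ShareEndpoint I J
  shareEndpoint-shift⇔ d =
    ⇔-sym (shareEndpoint⇔via {f = _+_ d} (+-cancelˡ-≡ d _ _))
    ⇔-∘ shareEndpoint⇔via {f = id} id

  precedes⇒¬overlaps : Precedes I J → ¬ Overlaps I J
  precedes⇒¬overlaps I≺J (overlapping _ loJ<hiI) = <-asym I≺J loJ<hiI

  precedes⇒¬shareEndpoint : Precedes I J → ¬ ShareEndpoint I J
  precedes⇒¬shareEndpoint I≺J (sharing nI nJ) =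
    <-irrefl refl (≤-<-trans (endpoint≤hi I nI) (<-≤-trans I≺J (lo≤endpoint J nJ)))
    where
    endpoint≤hi : ∀ {n} K → Endpoint n K → n ≤ hi K
    endpoint≤hi K (inj₁ refl) = <⇒≤ (lo<hi K)
    endpoint≤hi K (inj₂ refl) = ≤-refl

    lo≤endpoint : ∀ {n} K → Endpoint n K → lo K ≤ n
    lo≤endpoint K (inj₁ refl) = ≤-refl
    lo≤endpoint K (inj₂ refl) = <⇒≤ (lo<hi K)

  overlaps⇔ℤ : Overlaps I J ⇔ Overlap (+ lo I) (+ hi I) (+ lo J) (+ hi J)
  overlaps⇔ℤ = mk⇔ to-ℤ from-ℤ
    where
    to-ℤ : Overlaps I J → Overlap (+ lo I) (+ hi I) (+ lo J) (+ hi J)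
    to-ℤ (overlapping loI<hiJ loJ<hiI) =
      ℤ.+<+ (⊓-glb (⊔-lub (lo<hi I) loJ<hiI) (⊔-lub loI<hiJ (lo<hi J)))

    from-ℤ : Overlap (+ lo I) (+ hi I) (+ lo J) (+ hi J) → Overlaps I J
    from-ℤ (ℤ.+<+ max<min) = overlapping
      (≤-<-trans (m≤m⊔n (lo I) (lo J)) (<-≤-trans max<min (m⊓n≤n (hi I) (hi J))))
      (≤-<-trans (m≤n⊔m (lo I) (lo J)) (<-≤-trans max<min (m⊓n≤m (hi I) (hi J))))

record Box : Set where
  constructor box
  field
    xSpan ySpan : Interval
open Box

record InteriorsMeet (B C : Box) : Set where
  constructor meeting
  field
    x-overlap : Overlaps (xSpan B) (xSpan C)
    y-overlap : Overlaps (ySpan B) (ySpan C)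

data Touch (B C : Box) : Set where
  horizontal : ShareEndpoint (ySpan B) (ySpan C) → Overlaps (xSpan B) (xSpan C) → Touch B C
  vertical   : ShareEndpoint (xSpan B) (xSpan C) → Overlaps (ySpan B) (ySpan C) → Touch B C

data Separated (B C : Box) : Set where
  leftOf : Precedes (xSpan B) (xSpan C) → Separated B C
  below  : Precedes (ySpan B) (ySpan C) → Separated B C

transpose : Box → Box
transpose B = box (ySpan B) (xSpan B)

shiftBox : ℕ → ℕ → Box → Box
shiftBox dx dy B = box (shift dx (xSpan B)) (shift dy (ySpan B))

toRect : Box → Rect
toRect B = record
  { x₁ = + lo (xSpan B) ; x₂ = + hi (xSpan B) ; x₁<x₂ = ℤ.+<+ (lo<hi (xSpan B))
  ; y₁ = + lo (ySpan B) ; y₂ = + hi (ySpan B) ; y₁<y₂ = ℤ.+<+ (lo<hi (ySpan B))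
  }

module _ {B C : Box} where

  interiorsMeet-sym : InteriorsMeet B C → InteriorsMeet C B
  interiorsMeet-sym (meeting x y) = meeting (overlaps-sym x) (overlaps-sym y)

  touch-sym : Touch B C → Touch C B
  touch-sym (horizontal s o) = horizontal (shareEndpoint-sym s) (overlaps-sym o)
  touch-sym (vertical   s o) = vertical   (shareEndpoint-sym s) (overlaps-sym o)

  interiorsMeet-transpose⇔ : InteriorsMeet (transpose B) (transpose C) ⇔ InteriorsMeet B C
  interiorsMeet-transpose⇔ = mk⇔ (λ (meeting x y) → meeting y x) (λ (meeting x y) → meeting y x)

  touch-transpose⇔ : Touch (transpose B) (transpose C) ⇔ Touch B C
  touch-transpose⇔ = mk⇔
    (λ { (horizontal s o) → vertical s o ; (vertical s o) → horizontal s o })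
    (λ { (horizontal s o) → vertical s o ; (vertical s o) → horizontal s o })

  interiorsMeet-shift⇔ : ∀ dx dy →
    InteriorsMeet (shiftBox dx dy B) (shiftBox dx dy C) ⇔ InteriorsMeet B C
  interiorsMeet-shift⇔ dx dy = mk⇔
    (λ (meeting x y) → meeting (to (overlaps-shift⇔ dx) x) (to (overlaps-shift⇔ dy) y))
    (λ (meeting x y) → meeting (from (overlaps-shift⇔ dx) x) (from (overlaps-shift⇔ dy) y))

  touch-shift⇔ : ∀ dx dy → Touch (shiftBox dx dy B) (shiftBox dx dy C) ⇔ Touch B C
  touch-shift⇔ dx dy = mk⇔ unshift shift′
    where
    unshift : Touch (shiftBox dx dy B) (shiftBox dx dy C) → Touch B C
    unshift (horizontal s o) =
      horizontal (to (shareEndpoint-shift⇔ dy) s) (to (overlaps-shift⇔ dx) o)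
    unshift (vertical s o) =
      vertical (to (shareEndpoint-shift⇔ dx) s) (to (overlaps-shift⇔ dy) o)

    shift′ : Touch B C → Touch (shiftBox dx dy B) (shiftBox dx dy C)
    shift′ (horizontal s o) =
      horizontal (from (shareEndpoint-shift⇔ dy) s) (from (overlaps-shift⇔ dx) o)
    shift′ (vertical s o) =
      vertical (from (shareEndpoint-shift⇔ dx) s) (from (overlaps-shift⇔ dy) o)

  separated⇒¬interiorsMeet : Separated B C → ¬ InteriorsMeet B C
  separated⇒¬interiorsMeet (leftOf x≺) (meeting x _) = precedes⇒¬overlaps x≺ x
  separated⇒¬interiorsMeet (below  y≺) (meeting _ y) = precedes⇒¬overlaps y≺ y

  separated⇒¬touch : Separated B C → ¬ Touch B C
  separated⇒¬touch (leftOf x≺) (horizontal _ x) = precedes⇒¬overlaps x≺ x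
  separated⇒¬touch (leftOf x≺) (vertical   x _) = precedes⇒¬shareEndpoint x≺ x
  separated⇒¬touch (below  y≺) (horizontal y _) = precedes⇒¬shareEndpoint y≺ y
  separated⇒¬touch (below  y≺) (vertical   _ y) = precedes⇒¬overlaps y≺ y

  ¬interiorsMeet⇒interiorsDisjoint : ¬ InteriorsMeet B C → InteriorsDisjoint (toRect B) (toRect C)
  ¬interiorsMeet⇒interiorsDisjoint ¬meet (x , y) =
    ¬meet (meeting (from overlaps⇔ℤ x) (from overlaps⇔ℤ y))

  touch⇔shareBoundarySegment : Touch B C ⇔ ShareBoundarySegment (toRect B) (toRect C)
  touch⇔shareBoundarySegment = mk⇔ toSegment fromSegment
    where
    toSegment : Touch B C → ShareBoundarySegment (toRect B) (toRect C)
    toSegment (horizontal s o) =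
      let c , cB , cC = to (shareEndpoint⇔via ℤ.+-injective) s
      in  inj₁ (c , cB , cC , to overlaps⇔ℤ o)
    toSegment (vertical s o) =
      let c , cB , cC = to (shareEndpoint⇔via ℤ.+-injective) s
      in  inj₂ (c , cB , cC , to overlaps⇔ℤ o)

    fromSegment : ShareBoundarySegment (toRect B) (toRect C) → Touch B C
    fromSegment (inj₁ (c , cB , cC , o)) =
      horizontal (from (shareEndpoint⇔via ℤ.+-injective) (c , cB , cC)) (from overlaps⇔ℤ o)
    fromSegment (inj₂ (c , cB , cC , o)) =
      vertical (from (shareEndpoint⇔via ℤ.+-injective) (c , cB , cC)) (from overlaps⇔ℤ o)

-- Paths here are read from the root, whereas TreeVertex stores them leaf first.
data ParentOf {A : Set} : List A → List A → Set where
  root-parent : ∀ {i} → ParentOf [] (i ∷ [])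
  within      : ∀ {i p q} → ParentOf p q → ParentOf (i ∷ p) (i ∷ q)

Adjacent : {A : Set} → List A → List A → Set
Adjacent p q = ParentOf p q ⊎ ParentOf q p

module _ {A : Set} where

  parentOf-∷ʳ : ∀ (p : List A) i → ParentOf p (p ∷ʳ i)
  parentOf-∷ʳ []      i = root-parent
  parentOf-∷ʳ (j ∷ p) i = within (parentOf-∷ʳ p i)

  parentOf⇒∷ʳ : ∀ {p q : List A} → ParentOf p q → ∃[ i ] (q ≡ p ∷ʳ i)
  parentOf⇒∷ʳ (root-parent {i}) = i , refl
  parentOf⇒∷ʳ (within {i} pq)   = Prod.map₂ (cong (i ∷_)) (parentOf⇒∷ʳ pq)

  cons⇔parentOf-reverse : ∀ {p q : List A} → (∃[ i ] (q ≡ i ∷ p)) ⇔ ParentOf (reverse p) (reverse q)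
  cons⇔parentOf-reverse {p} = mk⇔ to-reverse from-reverse
    where
    to-reverse : ∀ {q} → ∃[ i ] (q ≡ i ∷ p) → ParentOf (reverse p) (reverse q)
    to-reverse (i , refl) =
      subst (ParentOf (reverse p)) (sym (List.unfold-reverse i p)) (parentOf-∷ʳ (reverse p) i)

    from-reverse : ∀ {q} → ParentOf (reverse p) (reverse q) → ∃[ i ] (q ≡ i ∷ p)
    from-reverse {q} pq =
      let i , q≡ = parentOf⇒∷ʳ pq
      in  i , List.reverse-injective {x = q} (trans q≡ (sym (List.unfold-reverse i p)))

  adjacent-sym : ∀ {p q : List A} → Adjacent p q → Adjacent q p
  adjacent-sym = Sum.swap

  adjacent-∷⇔ : ∀ {i} {p q : List A} → Adjacent (i ∷ p) (i ∷ q) ⇔ Adjacent p q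
  adjacent-∷⇔ = mk⇔ (λ { (inj₁ (within pq)) → inj₁ pq ; (inj₂ (within qp)) → inj₂ qp })
                    (Sum.map within within)

  adjacent-head : ∀ {i j} {p q : List A} → Adjacent (i ∷ p) (j ∷ q) → i ≡ j
  adjacent-head (inj₁ (within _)) = refl
  adjacent-head (inj₂ (within _)) = refl

pathFromRoot : ∀ {k m} → TreeVertex k m → List (Fin k)
pathFromRoot v = reverse (proj₁ v)

module _ {k m : ℕ} where

  length-pathFromRoot : (v : TreeVertex k m) → length (pathFromRoot v) ≤ m
  length-pathFromRoot (p , |p|≤m) = subst (_≤ m) (sym (List.length-reverse p)) |p|≤m

  pathFromRoot-injective : {u v : TreeVertex k m} → pathFromRoot u ≡ pathFromRoot v → u ≡ v
  pathFromRoot-injective {p , _} {q , _} rp≡rq with List.reverse-injective {x = p} {y = q} rp≡rq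
  ... | refl = cong (p ,_) (≤-irrelevant _ _)

  treeAdj⇔adjacent : {u v : TreeVertex k m} → TreeAdj u v ⇔ Adjacent (pathFromRoot u) (pathFromRoot v)
  treeAdj⇔adjacent = cons⇔parentOf-reverse ⊎-⇔ cons⇔parentOf-reverse

module Construction (k : ℕ) .{{_ : NonZero k}} where

  W H : ℕ → ℕ
  W zero    = 1
  W (suc m) = suc (H m)
  H zero    = 1
  H (suc m) = k * suc (W m)

  W>0 : ∀ m → 0 < W m
  W>0 zero    = z<s
  W>0 (suc m) = z<s

  H>0 : ∀ m → 0 < H m
  H>0 zero    = z<s
  H>0 (suc m) = >-nonZero⁻¹ (k * suc (W m)) {{m*n≢0 k (suc (W m))}}

  rootBox : ℕ → Box
  rootBox m = box (interval 0 1 z<s) (interval 0 (H m) (H>0 m))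

  -- The leading 1 keeps every non-root box of a copy off the line y = 0, so that
  -- after transposition the grandchildren of the root stay clear of its strip.
  offset : ℕ → Fin k → ℕ
  offset m i = suc (toℕ i * suc (W m))

  place : ℕ → Fin k → Box → Box
  place m i B = shiftBox 1 (offset m i) (transpose B)

  -- The clause for a nonempty path at depth 0 is junk: such paths have no vertex.
  boxOf : ℕ → List (Fin k) → Box
  boxOf m       []      = rootBox m
  boxOf zero    (_ ∷ _) = rootBox zero
  boxOf (suc m) (i ∷ p) = place m i (boxOf m p)

  offset+W≡ : ∀ m i → offset m i + W m ≡ suc (toℕ i) * suc (W m)
  offset+W≡ m i = cong suc (+-comm (toℕ i * suc (W m)) (W m))

  offset+W≤H : ∀ m i → offset m i + W m ≤ H (suc m)
  offset+W≤H m i = ≤-trans (≤-reflexive (offset+W≡ m i)) (*-monoˡ-≤ (suc (W m)) (Fin.toℕ<n i))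

  offset+W<offset : ∀ m {i j : Fin k} → toℕ i < toℕ j → offset m i + W m < offset m j
  offset+W<offset m {i} i<j =
    ≤-<-trans (≤-reflexive (offset+W≡ m i)) (s≤s (*-monoˡ-≤ (suc (W m)) i<j))

  boxOf-bounded : ∀ m p → length p ≤ m →
                  hi (xSpan (boxOf m p)) ≤ W m × hi (ySpan (boxOf m p)) ≤ H m
  boxOf-bounded zero    []      _           = ≤-refl , ≤-refl
  boxOf-bounded (suc m) []      _           = s≤s z≤n , ≤-refl
  boxOf-bounded (suc m) (i ∷ p) (s≤s |p|≤m) =
    let x≤W , y≤H = boxOf-bounded m p |p|≤m
    in  s≤s y≤H , ≤-trans (+-monoʳ-≤ (offset m i) x≤W) (offset+W≤H m i)

  record WellPlaced (m : ℕ) (u v : List (Fin k)) : Set where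
    constructor wellPlaced
    field
      interiors-disjoint : ¬ InteriorsMeet (boxOf m u) (boxOf m v)
      touch⇔adjacent     : Touch (boxOf m u) (boxOf m v) ⇔ Adjacent u v

  wellPlaced-sym : ∀ {m u v} → WellPlaced m u v → WellPlaced m v u
  wellPlaced-sym (wellPlaced disjoint touch⇔adj) = wellPlaced
    (disjoint ∘ interiorsMeet-sym)
    (mk⇔ adjacent-sym adjacent-sym ⇔-∘ (touch⇔adj ⇔-∘ mk⇔ touch-sym touch-sym))

  separated⇒wellPlaced : ∀ {m u v} → Separated (boxOf m u) (boxOf m v) → ¬ Adjacent u v →
                         WellPlaced m u v
  separated⇒wellPlaced apart ¬adj = wellPlaced
    (separated⇒¬interiorsMeet apart)
    (mk⇔ (⊥-elim ∘ separated⇒¬touch apart) (⊥-elim ∘ ¬adj))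

  place-wellPlaced : ∀ {m u v} i → WellPlaced m u v → WellPlaced (suc m) (i ∷ u) (i ∷ v)
  place-wellPlaced {m} i (wellPlaced disjoint touch⇔adj) = wellPlaced
    (disjoint ∘ to (interiorsMeet-transpose⇔ ⇔-∘ interiorsMeet-shift⇔ 1 (offset m i)))
    (⇔-sym adjacent-∷⇔ ⇔-∘ (touch⇔adj ⇔-∘ (touch-transpose⇔ ⇔-∘ touch-shift⇔ 1 (offset m i))))

  root-child-wellPlaced : ∀ m j → WellPlaced (suc m) [] (j ∷ [])
  root-child-wellPlaced m j = wellPlaced
    (λ (meeting (overlapping _ 1<1) _) → <-irrefl refl 1<1)
    (mk⇔ (λ _ → inj₁ root-parent) (λ _ → strip-contact))
    where
    strip-contact : Touch (rootBox (suc m)) (boxOf (suc m) (j ∷ []))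
    strip-contact = vertical (sharing (inj₂ refl) (inj₁ refl))
      (overlapping z<s (<-≤-trans (+-monoʳ-< (offset m j) (W>0 m)) (offset+W≤H m j)))

  root-wellPlaced : ∀ m j p → length p ≤ m → WellPlaced (suc m) [] (j ∷ p)
  root-wellPlaced m       j []      _       = root-child-wellPlaced m j
  root-wellPlaced (suc m) j (l ∷ p) (s≤s _) =
    separated⇒wellPlaced (leftOf (s≤s (s≤s z≤n))) λ { (inj₁ ()) ; (inj₂ ()) }

  siblings-wellPlaced : ∀ m {i j u v} → toℕ i < toℕ j → length u ≤ m →
                        WellPlaced (suc m) (i ∷ u) (j ∷ v)
  siblings-wellPlaced m {i} {j} {u} {v} i<j |u|≤m =
    separated⇒wellPlaced (below i-below-j) (λ adj → <-irrefl (cong toℕ (adjacent-head adj)) i<j)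
    where
    i-below-j : Precedes (ySpan (boxOf (suc m) (i ∷ u))) (ySpan (boxOf (suc m) (j ∷ v)))
    i-below-j = begin-strict
      offset m i + hi (xSpan (boxOf m u)) ≤⟨ +-monoʳ-≤ (offset m i) u-within-W ⟩
      offset m i + W m                    <⟨ offset+W<offset m i<j ⟩
      offset m j                          ≤⟨ m≤m+n (offset m j) _ ⟩
      offset m j + lo (xSpan (boxOf m v)) ∎
      where
      open ≤-Reasoning
      u-within-W : hi (xSpan (boxOf m u)) ≤ W m
      u-within-W = proj₁ (boxOf-bounded m u |u|≤m)

  boxOf-wellPlaced : ∀ m u v → length u ≤ m → length v ≤ m → u ≢ v → WellPlaced m u v
  boxOf-wellPlaced m [] [] _ _ u≢v = contradiction refl u≢v
  boxOf-wellPlaced (suc m) [] (j ∷ v) _ (s≤s |v|≤m) _ = root-wellPlaced m j v |v|≤m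
  boxOf-wellPlaced (suc m) (i ∷ u) [] (s≤s |u|≤m) _ _ = wellPlaced-sym (root-wellPlaced m i u |u|≤m)
  boxOf-wellPlaced (suc m) (i ∷ u) (j ∷ v) (s≤s |u|≤m) (s≤s |v|≤m) u≢v with Fin.<-cmp i j
  ... | tri< i<j _ _ = siblings-wellPlaced m i<j |u|≤m
  ... | tri> _ _ j<i = wellPlaced-sym (siblings-wellPlaced m j<i |v|≤m)
  ... | tri≈ _ refl _ =
    place-wellPlaced i (boxOf-wellPlaced m u v |u|≤m |v|≤m (u≢v ∘ cong (i ∷_)))

  layout : ∀ m → RectLayout (TreeVertex k m) TreeAdj
  layout m = record
    { rect     = λ v → toRect (boxOf m (pathFromRoot v))
    ; disjoint = λ u v u≢v →
        ¬interiorsMeet⇒interiorsDisjoint (WellPlaced.interiors-disjoint (placed u≢v))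
    ; contact  = λ u v u≢v →
        ⇔-sym (treeAdj⇔adjacent {u = u} {v}) ⇔-∘
        (WellPlaced.touch⇔adjacent (placed u≢v) ⇔-∘ ⇔-sym touch⇔shareBoundarySegment)
    }
    where
    placed : ∀ {u v} → u ≢ v → WellPlaced m (pathFromRoot u) (pathFromRoot v)
    placed {u} {v} u≢v = boxOf-wellPlaced m _ _ (length-pathFromRoot u) (length-pathFromRoot v)
                                           (u≢v ∘ pathFromRoot-injective)

  padded-area≤ : 2 ≤ k → ∀ m → (W m + 3) * (H m + 4) ≤ 20 * k ^ m
  padded-area≤ 2≤k zero    = ≤-refl
  padded-area≤ 2≤k (suc m) = begin
    (W (suc m) + 3) * (H (suc m) + 4)     ≡⟨ *-comm (W (suc m) + 3) _ ⟩
    (k * suc (W m) + 4) * (suc (H m) + 3) ≡⟨ cong ((k * suc (W m) + 4) *_) (sym (+-suc (H m) 3)) ⟩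
    (k * suc (W m) + 4) * (H m + 4)       ≤⟨ *-monoˡ-≤ (H m + 4) k[1+W]+4≤k[W+3] ⟩
    k * (W m + 3) * (H m + 4)             ≡⟨ *-assoc k (W m + 3) (H m + 4) ⟩
    k * ((W m + 3) * (H m + 4))           ≤⟨ *-monoʳ-≤ k (padded-area≤ 2≤k m) ⟩
    k * (20 * k ^ m)                      ≡⟨ x∙yz≈y∙xz k 20 (k ^ m) ⟩
    20 * k ^ suc m                        ∎
    where
    open ≤-Reasoning
    k[1+W]+4≤k[W+3] : k * suc (W m) + 4 ≤ k * (W m + 3)
    k[1+W]+4≤k[W+3] = begin
      k * suc (W m) + 4      ≤⟨ +-monoʳ-≤ (k * suc (W m)) (*-monoˡ-≤ 2 2≤k) ⟩
      k * suc (W m) + k * 2  ≡⟨ *-distribˡ-+ k (suc (W m)) 2 ⟨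
      k * (suc (W m) + 2)    ≡⟨ cong (k *_) (+-suc (W m) 2) ⟨
      k * (W m + 3)          ∎

  layout-area : 2 ≤ k → ∀ m → AreaAtMost (layout m) (+ (20 * k ^ m))
  layout-area 2≤k m = + 0 , + W m , + 0 , + H m , inBox , area≤
    where
    inBox : ∀ v → InBox (+ 0) (+ W m) (+ 0) (+ H m) (rect (layout m) v)
    inBox v = let x≤W , y≤H = boxOf-bounded m (pathFromRoot v) (length-pathFromRoot v)
              in  ℤ.+≤+ z≤n , ℤ.+≤+ x≤W , ℤ.+≤+ z≤n , ℤ.+≤+ y≤H

    area≤ : (+ W m ℤ.- + 0) ℤ.* (+ H m ℤ.- + 0) ℤ.≤ + (20 * k ^ m)
    area≤ = begin
      (+ W m ℤ.- + 0) ℤ.* (+ H m ℤ.- + 0)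
        ≡⟨ cong₂ ℤ._*_ (ℤ.+-identityʳ (+ W m)) (ℤ.+-identityʳ (+ H m)) ⟩
      + W m ℤ.* + H m                     ≡⟨ ℤ.pos-* (W m) (H m) ⟨
      + (W m * H m)                       ≤⟨ ℤ.+≤+ (*-mono-≤ (m≤m+n (W m) 3) (m≤m+n (H m) 4)) ⟩
      + ((W m + 3) * (H m + 4))           ≤⟨ ℤ.+≤+ (padded-area≤ 2≤k m) ⟩
      + (20 * k ^ m)                      ∎
      where open ℤ.≤-Reasoning

theorem8 : (k : ℕ) → 2 ≤ k →
    ∃[ C ] ((m : ℕ) →
      Σ (RectLayout (TreeVertex k m) TreeAdj) (λ L → AreaAtMost L (+ (C * k ^ m))))
theorem8 k 2≤k = 20 , λ m → layout m , layout-area 2≤k m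
  where
  instance
    k≢0 : NonZero k
    k≢0 = >-nonZero (<-≤-trans z<s 2≤k)
  open Construction k
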